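{- Let $X$ be a straight line Coxeter graph with vertices $s_1,\dots,s_n$, where $s_i,s_j$ are adjacent iff $|i-j|=1$, and let $E$ be the heap of a fully commutative $w\in W(X)$. (i) If $m(s_j,s_{j+1})=3$ for all $j\ge i$ and $w$ has a reduced expression of the form $\mathbf{x}s_i\mathbf{y}s_i\mathbf{z}$ (with $\mathbf{x},\mathbf{y},\mathbf{z}$ words in the generators), then $s_{i-1}$ occurs in $\mathbf{y}$. (ii) If $m(s_j,s_{j+1})=3$ for all $j\le i$ and $w$ has a reduced expression of the form $\mathbf{x}s_i\mathbf{y}s_i\mathbf{z}$, then $s_{i+1}$ occurs in $\mathbf{y}$.
   Context: An element is fully commutative if any two of its reduced expressions are related by repeatedly swapping adjacent commuting generators; the set of all such reduced expressions (its commutation class, or trace) is what is meant by a trace of the heap of $w$. -}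

module Defs where

open import Data.Nat using (ℕ; zero; suc; _<_; _≤_)
open import Data.Fin using (Fin; toℕ)
open import Data.List using (List; []; _∷_; _++_; length)
open import Data.List.Membership.Propositional using (_∈_)
open import Data.Sum using (_⊎_)
open import Data.Product using (∃; _×_; _,_)
open import Relation.Binary.PropositionalEquality using (_≡_; _≢_)
open import Relation.Nullary using (¬_)
open import Relation.Binary.Construct.Closure.Equivalence using (EqClosure)
open import Relation.Binary.Construct.Closure.ReflexiveTransitive using (Star)

data ℕ∞ : Set where
  fin : ℕ → ℕ∞
  ∞   : ℕ∞

-- Generators s_1 … s_n are represented by Fin n (s_{k+1} ↔ index k).
Word : ℕ → Set
Word n = List (Fin n)

Adjacent : {n : ℕ} → Fin n → Fin n → Set
Adjacent s t = (suc (toℕ s) ≡ toℕ t) ⊎ (suc (toℕ t) ≡ toℕ s)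

record IsStraightLineCoxeter {n : ℕ} (M : Fin n → Fin n → ℕ∞) : Set where
  field
    diag      : ∀ s → M s s ≡ fin 1
    symm      : ∀ s t → M s t ≡ M t s
    nonadj    : ∀ s t → s ≢ t → ¬ Adjacent s t → M s t ≡ fin 2
    adj       : ∀ s t → Adjacent s t → (M s t ≡ ∞) ⊎ (∃ λ k → (3 ≤ k) × (M s t ≡ fin k))

alt : {n : ℕ} → Fin n → Fin n → ℕ → Word n
alt s t zero    = []
alt s t (suc k) = s ∷ alt t s k

-- Defining relations of W(M) (as relations between words of a monoid
-- presentation; since generators are involutions this presents the group):
-- s s = 1 and the braid relations (s t s …)_m = (t s t …)_m for m finite.
data Rel {n : ℕ} (M : Fin n → Fin n → ℕ∞) : Word n → Word n → Set where
  invol : ∀ s → Rel M (s ∷ s ∷ []) []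
  braid : ∀ s t k → M s t ≡ fin k → Rel M (alt s t k) (alt t s k)

data Step {n : ℕ} (M : Fin n → Fin n → ℕ∞) : Word n → Word n → Set where
  step : ∀ u a b v → Rel M a b → Step M (u ++ a ++ v) (u ++ b ++ v)

_≈[_]_ : {n : ℕ} → Word n → (Fin n → Fin n → ℕ∞) → Word n → Set
u ≈[ M ] v = EqClosure (Step M) u v

Reduced : {n : ℕ} → (Fin n → Fin n → ℕ∞) → Word n → Set
Reduced M u = ∀ v → v ≈[ M ] u → length u ≤ length v

data CommStep {n : ℕ} (M : Fin n → Fin n → ℕ∞) : Word n → Word n → Set where
  swap : ∀ u s t v → M s t ≡ fin 2 → CommStep M (u ++ s ∷ t ∷ v) (u ++ t ∷ s ∷ v)

_~c[_]_ : {n : ℕ} → Word n → (Fin n → Fin n → ℕ∞) → Word n → Set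
u ~c[ M ] v = Star (CommStep M) u v

FullyCommutative : {n : ℕ} → (Fin n → Fin n → ℕ∞) → Word n → Set
FullyCommutative M w =
  ∀ u v → u ≈[ M ] w → v ≈[ M ] w → Reduced M u → Reduced M v → u ~c[ M ] v

-- Suppose, in part (i), that no s_{i-1} occurs between the two copies of a = s_i.
-- If the factor a q a (q free of a and of the predecessor of a) contains no
-- successor b of a, then a commutes with q and the two copies cancel. If b occurs
-- exactly once, commuting both copies of a up to it produces a reduced expression
-- containing the braid a b a with m(a, b) = 3; the braid move gives a second
-- reduced expression, and the two cannot be commutation equivalent, because
-- erasing every letter other than a and b is invariant under commutations.
-- If b occurs at least twice, the first two occurrences of b enclose a shorter
-- word free of b and of its predecessor a, and the argument repeats one step
-- further along the line. Part (ii) is the mirror image.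
module Submission where

open import Defs
open import Data.Nat using (ℕ; zero; suc; _+_; _<_; _≤_; s≤s) renaming (_≟_ to _≟ℕ_)
open import Data.Nat.Properties
  using (≤-refl; ≤-trans; ≤-reflexive; <⇒≤; <⇒≱; n≤1+n; suc-injective; m<n⇒m<1+n;
         module ≤-Reasoning)
open import Data.Nat.Induction using (<-wellFounded)
open import Data.Fin using (Fin; toℕ; _≟_)
open import Data.Fin.Properties using (toℕ-injective)
open import Data.List using (List; []; _∷_; _++_; length; filter)
open import Data.List.Properties
  using (++-assoc; length-++; length-++-≤ˡ; ++-cancelˡ; ∷-injectiveˡ;
         filter-++; filter-all; filter-accept; filter-reject)
open import Data.List.Membership.Propositional using (_∈_; find)
open import Data.List.Relation.Unary.All as All using (All; []; _∷_)
open import Data.List.Relation.Unary.All.Properties as Allₚ using (¬Any⇒All¬)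
open import Data.List.Relation.Unary.Any using (any?)
open import Data.List.Relation.Unary.First as First using (FirstView; first)
open import Data.List.Relation.Unary.First.Properties using (toView)
open import Data.Product using (∃; _×_; _,_; proj₁; proj₂; uncurry)
open import Data.Sum as Sum using (_⊎_; inj₁; inj₂)
open import Data.Empty using (⊥-elim)
open import Level using (0ℓ)
open import Function using (id; flip; _∘_)
open import Induction.WellFounded using (Acc; acc)
open import Relation.Nullary using (¬_; Dec; yes; no; contradiction)
open import Relation.Nullary.Decidable using (_⊎-dec_; toSum)
open import Relation.Unary using (Pred; Decidable; ∁)
open import Relation.Binary.PropositionalEquality
  using (_≡_; _≢_; refl; sym; trans; cong; subst; ≢-sym; module ≡-Reasoning)
open import Relation.Binary.Construct.Closure.ReflexiveTransitive as Star
  using (ε; _◅_; _◅◅_)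
open import Relation.Binary.Construct.Closure.Symmetric using (fwd)
import Relation.Binary.Construct.Closure.Equivalence as EqClosure

module _ {A : Set} where

  split-first : {P : Pred A 0ℓ} → Decidable P → ∀ xs → FirstView (∁ P) P xs ⊎ All (∁ P) xs
  split-first P? xs = Sum.map₁ toView (first (Sum.swap ∘ toSum ∘ P?) xs)

  length-<-between : ∀ xs {y y′ : A} ys {zs} → length ys < length (xs ++ y ∷ ys ++ y′ ∷ zs)
  length-<-between []       ys = s≤s (length-++-≤ˡ ys)
  length-<-between (x ∷ xs) ys = m<n⇒m<1+n (length-<-between xs ys)

  length-++-middle : ∀ p {xs ys : List A} r → length xs ≡ length ys →
                     length (p ++ xs ++ r) ≡ length (p ++ ys ++ r)
  length-++-middle []      {xs} {ys} r eq =
    trans (length-++ xs) (trans (cong (_+ length r) eq) (sym (length-++ ys)))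
  length-++-middle (_ ∷ p)           r eq = cong suc (length-++-middle p r eq)

  length-++-<-∷∷ : ∀ xs {y y′ : A} {ys} → length (xs ++ ys) < length (xs ++ y ∷ y′ ∷ ys)
  length-++-<-∷∷ []       = s≤s (n≤1+n _)
  length-++-<-∷∷ (x ∷ xs) = s≤s (length-++-<-∷∷ xs)

module _ {n : ℕ} where

  length-alt : ∀ (s t : Fin n) k → length (alt s t k) ≡ k
  length-alt s t zero    = refl
  length-alt s t (suc k) = cong suc (length-alt t s k)

  All-alt : ∀ {P : Pred (Fin n) 0ℓ} {s t} → P s → P t → ∀ k → All P (alt s t k)
  All-alt ps pt zero    = []
  All-alt ps pt (suc k) = ps ∷ All-alt pt ps k

  _⋖_ : Fin n → Fin n → Set
  s ⋖ t = suc (toℕ s) ≡ toℕ t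

  _⋖?_ : ∀ s t → Dec (s ⋖ t)
  s ⋖? t = suc (toℕ s) ≟ℕ toℕ t

  ⋖-functional : ∀ {s t t′} → s ⋖ t → s ⋖ t′ → t ≡ t′
  ⋖-functional st st′ = toℕ-injective (trans (sym st) st′)

  ⋖-injective : ∀ {s s′ t} → s ⋖ t → s′ ⋖ t → s ≡ s′
  ⋖-injective st s′t = toℕ-injective (suc-injective (trans st (sym s′t)))

  ⋖⇒≤ : ∀ {s t} → s ⋖ t → toℕ s ≤ toℕ t
  ⋖⇒≤ = <⇒≤ ∘ ≤-reflexive

module CoxeterWords {n : ℕ} (M : Fin n → Fin n → ℕ∞)
  (diag : ∀ s → M s s ≡ fin 1) (symm : ∀ s t → M s t ≡ M t s) where

  Commute : Fin n → Fin n → Set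
  Commute s t = M s t ≡ fin 2

  _≈_ : Word n → Word n → Set
  u ≈ v = u ≈[ M ] v

  _~c_ : Word n → Word n → Set
  u ~c v = u ~c[ M ] v

  ≈-sym : ∀ {u v} → u ≈ v → v ≈ u
  ≈-sym = EqClosure.symmetric (Step M)

  ~c-∷ : ∀ c {u v} → u ~c v → (c ∷ u) ~c (c ∷ v)
  ~c-∷ c = Star.gmap (c ∷_) λ { (swap u s t v st) → swap (c ∷ u) s t v st }

  ~c-prefix : ∀ p {u v} → u ~c v → (p ++ u) ~c (p ++ v)
  ~c-prefix []      uv = uv
  ~c-prefix (c ∷ p) uv = ~c-∷ c (~c-prefix p uv)

  ~c-sym : ∀ {u v} → u ~c v → v ~c u
  ~c-sym = Star.reverse λ { (swap u s t v st) → swap u t s v (trans (symm t s) st) }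

  ~c⇒≈ : ∀ {u v} → u ~c v → u ≈ v
  ~c⇒≈ = Star.map λ { (swap u s t v st) →
    fwd (step u (s ∷ t ∷ []) (t ∷ s ∷ []) v (braid s t 2 st)) }

  ~c-length : ∀ {u v} → u ~c v → length u ≡ length v
  ~c-length ε                        = refl
  ~c-length (swap u s t v _ ◅ uv) = trans (trans (length-++ u) (sym (length-++ u))) (~c-length uv)

  commute-past : ∀ {a q r} → All (Commute a) q → (a ∷ q ++ r) ~c (q ++ a ∷ r)
  commute-past             []        = ε
  commute-past {a} {c ∷ q} (ac ∷ aq) = swap [] a c _ ac ◅ ~c-∷ c (commute-past aq)

  gather : ∀ {a b q₁ q₂ r} → All (Commute a) q₁ → All (Commute a) q₂ →
           (a ∷ q₁ ++ b ∷ q₂ ++ a ∷ r) ~c (q₁ ++ a ∷ b ∷ a ∷ q₂ ++ r)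
  gather {a} {b} {q₁} aq₁ aq₂ =
    commute-past aq₁ ◅◅ ~c-prefix q₁ (~c-∷ a (~c-∷ b (~c-sym (commute-past aq₂))))

  ReducedExpression : Word n → Word n → Set
  ReducedExpression w u = u ≈ w × Reduced M u

  shorter⇒¬reduced : ∀ {u v} → u ≈ v → length v < length u → ¬ Reduced M u
  shorter⇒¬reduced u≈v v<u red = <⇒≱ v<u (red _ (≈-sym u≈v))

  ReducedExpression-resp : ∀ {w u v} → u ≈ v → length u ≡ length v →
                           ReducedExpression w u → ReducedExpression w v
  ReducedExpression-resp u≈v len (u≈w , red) =
    ≈-sym u≈v ◅◅ u≈w , λ v′ v′≈v → subst (_≤ length v′) len (red v′ (v′≈v ◅◅ ≈-sym u≈v))

  ReducedExpression-resp-~c : ∀ {w u v} → u ~c v → ReducedExpression w u → ReducedExpression w v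
  ReducedExpression-resp-~c u~v = ReducedExpression-resp (~c⇒≈ u~v) (~c-length u~v)

  commuting-repeat-¬reduced : ∀ {a q} p r → All (Commute a) q → ¬ Reduced M (p ++ a ∷ q ++ a ∷ r)
  commuting-repeat-¬reduced {a} {q} p r aq = shorter⇒¬reduced cancel shorter
    where
    moved : (p ++ a ∷ q ++ a ∷ r) ~c ((p ++ q) ++ a ∷ a ∷ r)
    moved = subst ((p ++ a ∷ q ++ a ∷ r) ~c_) (sym (++-assoc p q _)) (~c-prefix p (commute-past aq))

    cancel : (p ++ a ∷ q ++ a ∷ r) ≈ ((p ++ q) ++ r)
    cancel = ~c⇒≈ moved ◅◅ fwd (step (p ++ q) (a ∷ a ∷ []) [] r (invol a)) ◅ ε

    shorter : length ((p ++ q) ++ r) < length (p ++ a ∷ q ++ a ∷ r)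
    shorter = begin-strict
      length ((p ++ q) ++ r)           <⟨ length-++-<-∷∷ (p ++ q) ⟩
      length ((p ++ q) ++ a ∷ a ∷ r)   ≡⟨ ~c-length moved ⟨
      length (p ++ a ∷ q ++ a ∷ r)     ∎
      where open ≤-Reasoning

  module _ {P : Pred (Fin n) 0ℓ} (P? : Decidable P)
           (noncommuting : ∀ {s t} → P s → P t → ¬ Commute s t) where

    filter-swap : ∀ {s t} → Commute s t → ∀ v → filter P? (s ∷ t ∷ v) ≡ filter P? (t ∷ s ∷ v)
    filter-swap {s} {t} st v with P? s | P? t
    ... | yes ps | yes pt = contradiction st (noncommuting ps pt)
    ... | yes ps | no ¬pt = trans (cong (s ∷_) (filter-reject P? ¬pt)) (sym (filter-accept P? ps))
    ... | no ¬ps | yes pt = trans (filter-accept P? pt) (cong (t ∷_) (sym (filter-reject P? ¬ps)))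
    ... | no ¬ps | no ¬pt = trans (filter-reject P? ¬pt) (sym (filter-reject P? ¬ps))

    filter-~c : ∀ {u v} → u ~c v → filter P? u ≡ filter P? v
    filter-~c ε = refl
    filter-~c (swap u s t v st ◅ uv) = begin
      filter P? (u ++ s ∷ t ∷ v)              ≡⟨ filter-++ P? u _ ⟩
      filter P? u ++ filter P? (s ∷ t ∷ v)    ≡⟨ cong (filter P? u ++_) (filter-swap st v) ⟩
      filter P? u ++ filter P? (t ∷ s ∷ v)    ≡⟨ filter-++ P? u _ ⟨
      filter P? (u ++ t ∷ s ∷ v)              ≡⟨ filter-~c uv ⟩
      _                                       ∎
      where open ≡-Reasoning

  fully-commutative⇒braid-free : ∀ {w a b m} → FullyCommutative M w → M a b ≡ fin m → 3 ≤ m →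
                                 ∀ p r → ¬ ReducedExpression w (p ++ alt a b m ++ r)
  fully-commutative⇒braid-free {w} {a} {b} {m} fc ab (s≤s (s≤s (s≤s _))) p r rexp =
    contradiction (trans (sym (diag a)) (subst (λ c → M a c ≡ fin m) (sym a≡b) ab)) λ ()
    where
    u v : Word n
    u = p ++ alt a b m ++ r
    v = p ++ alt b a m ++ r

    rexp′ : ReducedExpression w v
    rexp′ = ReducedExpression-resp (fwd (step p _ _ r (braid a b m ab)) ◅ ε)
              (length-++-middle p r (trans (length-alt a b m) (sym (length-alt b a m)))) rexp

    P : Pred (Fin n) 0ℓ
    P c = c ≡ a ⊎ c ≡ b

    P? : Decidable P
    P? c = (c ≟ a) ⊎-dec (c ≟ b)

    entry : ∀ {s t} → P s → P t → M s t ≡ fin 1 ⊎ M s t ≡ fin m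
    entry (inj₁ refl) (inj₁ refl) = inj₁ (diag a)
    entry (inj₁ refl) (inj₂ refl) = inj₂ ab
    entry (inj₂ refl) (inj₁ refl) = inj₂ (trans (symm b a) ab)
    entry (inj₂ refl) (inj₂ refl) = inj₁ (diag b)

    noncommuting : ∀ {s t} → P s → P t → ¬ Commute s t
    noncommuting ps pt st with entry ps pt
    ... | inj₁ e = contradiction (trans (sym e) st) λ ()
    ... | inj₂ e = contradiction (trans (sym e) st) λ ()

    filtered : ∀ s t → P s → P t →
               filter P? (p ++ alt s t m ++ r) ≡ filter P? p ++ alt s t m ++ filter P? r
    filtered s t ps pt = trans (filter-++ P? p _)
      (cong (filter P? p ++_) (trans (filter-++ P? (alt s t m) r)
        (cong (_++ filter P? r) (filter-all P? (All-alt ps pt m)))))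

    u~v : u ~c v
    u~v = fc u v (proj₁ rexp) (proj₁ rexp′) (proj₂ rexp) (proj₂ rexp′)

    a≡b : a ≡ b
    a≡b = ∷-injectiveˡ (++-cancelˡ (filter P? p) _ _ (begin
      filter P? p ++ alt a b m ++ filter P? r   ≡⟨ filtered a b (inj₁ refl) (inj₂ refl) ⟨
      filter P? u                               ≡⟨ filter-~c P? noncommuting u~v ⟩
      filter P? v                               ≡⟨ filtered b a (inj₂ refl) (inj₁ refl) ⟩
      filter P? p ++ alt b a m ++ filter P? r   ∎))
      where open ≡-Reasoning

-- s ⟶ t: t is the next generator after s in a fixed direction along the line;
-- InTail is a final segment of the line on which all bonds are simple.
module StraightLineRay {n : ℕ} {M : Fin n → Fin n → ℕ∞} (straight : IsStraightLineCoxeter M)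
  {w : Word n} (fc : FullyCommutative M w)
  (_⟶_ : Fin n → Fin n → Set) (_⟶?_ : ∀ s t → Dec (s ⟶ t))
  (adjacent⇒⟶ : ∀ {s t} → Adjacent s t → s ⟶ t ⊎ t ⟶ s)
  (⟶-functional : ∀ {s t t′} → s ⟶ t → s ⟶ t′ → t ≡ t′)
  (⟶-injective : ∀ {s s′ t} → s ⟶ t → s′ ⟶ t → s ≡ s′)
  (InTail : Fin n → Set)
  (InTail-step : ∀ {s t} → InTail s → s ⟶ t → InTail t)
  (InTail-simple : ∀ {s t} → InTail s → s ⟶ t → M s t ≡ fin 3) where

  open IsStraightLineCoxeter straight
  open CoxeterWords M diag symm

  Clear : Fin n → Fin n → Set
  Clear a c = c ≢ a × ¬ c ⟶ a

  clear⇒commute : ∀ {a q} → All (Clear a) q → All (λ c → ¬ a ⟶ c) q → All (Commute a) q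
  clear⇒commute clear a↛q = All.zipWith (uncurry commute) (clear , a↛q)
    where
    commute : ∀ {a c} → Clear a c → ¬ a ⟶ c → Commute a c
    commute (c≢a , c↛a) a↛c = nonadj _ _ (≢-sym c≢a) (Sum.[ a↛c , c↛a ] ∘ adjacent⇒⟶)

  clear-step : ∀ {a b q} → a ⟶ b → All (Clear a) q → All (λ c → ¬ a ⟶ c) q → All (Clear b) q
  clear-step {a} {b} ab clear a↛q = All.zipWith (uncurry still-clear) (clear , a↛q)
    where
    still-clear : ∀ {c} → Clear a c → ¬ a ⟶ c → Clear b c
    still-clear (c≢a , _) a↛c = (λ { refl → a↛c ab }) , λ cb → c≢a (⟶-injective cb ab)

  sandwiched-braid-¬reduced : ∀ {a b q₁ q₂} p r → InTail a → a ⟶ b →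
    All (Commute a) q₁ → All (Commute a) q₂ →
    ¬ ReducedExpression w (p ++ a ∷ (q₁ ++ b ∷ q₂) ++ a ∷ r)
  sandwiched-braid-¬reduced {a} {b} {q₁} {q₂} p r tail ab aq₁ aq₂ rexp =
    fully-commutative⇒braid-free fc (InTail-simple tail ab) ≤-refl (p ++ q₁) (q₂ ++ r)
      (subst (ReducedExpression w) (sym (++-assoc p q₁ _)) (ReducedExpression-resp-~c gathered rexp))
    where
    gathered : (p ++ a ∷ (q₁ ++ b ∷ q₂) ++ a ∷ r) ~c (p ++ q₁ ++ a ∷ b ∷ a ∷ q₂ ++ r)
    gathered = ~c-prefix p (subst (λ q → (a ∷ q) ~c (q₁ ++ a ∷ b ∷ a ∷ q₂ ++ r))
                                  (sym (++-assoc q₁ _ _)) (gather aq₁ aq₂))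

  no-clear-repeat : ∀ {a} p q r → Acc _<_ (length q) → InTail a → All (Clear a) q →
                    ¬ ReducedExpression w (p ++ a ∷ q ++ a ∷ r)
  no-clear-repeat {a} p q r (acc smaller) tail clear rexp with split-first (a ⟶?_) q
  ... | inj₂ a↛q = commuting-repeat-¬reduced p r (clear⇒commute clear a↛q) (proj₂ rexp)
  ... | inj₁ (First._++_∷_ {q₁} {b} a↛q₁ ab q′) with Allₚ.++⁻ q₁ clear
  ... | clear₁ , _ ∷ clear′ with split-first (a ⟶?_) q′
  ... | inj₂ a↛q′ = sandwiched-braid-¬reduced p r tail ab
                      (clear⇒commute clear₁ a↛q₁) (clear⇒commute clear′ a↛q′) rexp
  ... | inj₁ (First._++_∷_ {q₂} a↛q₂ ab′ q₃) with ⟶-functional ab ab′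
  ... | refl = no-clear-repeat (p ++ a ∷ q₁) q₂ (q₃ ++ a ∷ r) (smaller (length-<-between q₁ q₂))
                 (InTail-step tail ab)
                 (clear-step ab (Allₚ.++⁻ˡ q₂ clear′) a↛q₂)
                 (subst (ReducedExpression w) regroup rexp)
    where
    regroup : p ++ a ∷ (q₁ ++ b ∷ q₂ ++ b ∷ q₃) ++ a ∷ r ≡
              (p ++ a ∷ q₁) ++ b ∷ q₂ ++ b ∷ q₃ ++ a ∷ r
    regroup = begin
      p ++ a ∷ (q₁ ++ b ∷ q₂ ++ b ∷ q₃) ++ a ∷ r
        ≡⟨ cong (λ q → p ++ a ∷ q) (++-assoc q₁ _ _) ⟩
      p ++ a ∷ q₁ ++ b ∷ (q₂ ++ b ∷ q₃) ++ a ∷ r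
        ≡⟨ cong (λ q → p ++ a ∷ q₁ ++ b ∷ q) (++-assoc q₂ _ _) ⟩
      p ++ a ∷ q₁ ++ b ∷ q₂ ++ b ∷ q₃ ++ a ∷ r
        ≡⟨ ++-assoc p (a ∷ q₁) _ ⟨
      (p ++ a ∷ q₁) ++ b ∷ q₂ ++ b ∷ q₃ ++ a ∷ r
        ∎
      where open ≡-Reasoning

  no-repeat : ∀ {a} x y z → InTail a → All (λ c → ¬ c ⟶ a) y →
              ¬ ReducedExpression w (x ++ a ∷ y ++ a ∷ z)
  no-repeat {a} x y z tail y↛a rexp with split-first (_≟ a) y
  ... | inj₂ y≢a = no-clear-repeat x y z (<-wellFounded _) tail (All.zip (y≢a , y↛a)) rexp
  ... | inj₁ (First._++_∷_ {y₁} y₁≢a refl y₂) =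
    no-clear-repeat x y₁ (y₂ ++ a ∷ z) (<-wellFounded _) tail
      (All.zip (y₁≢a , Allₚ.++⁻ˡ y₁ y↛a))
      (subst (ReducedExpression w) (cong (λ v → x ++ a ∷ v) (++-assoc y₁ _ _)) rexp)

lemma4p3p2 : (n : ℕ) (M : Fin n → Fin n → ℕ∞) → IsStraightLineCoxeter M →
    (w : Word n) → FullyCommutative M w →
    (i : Fin n) (x y z : Word n) → w ≈[ M ] (x ++ i ∷ y ++ i ∷ z) →
    Reduced M (x ++ i ∷ y ++ i ∷ z) →
    ((∀ (s t : Fin n) → toℕ i ≤ toℕ s → suc (toℕ s) ≡ toℕ t → M s t ≡ fin 3) →
      ∃ λ (j : Fin n) → (j ∈ y) × (suc (toℕ j) ≡ toℕ i))
    × ((∀ (s t : Fin n) → toℕ s ≤ toℕ i → suc (toℕ s) ≡ toℕ t → M s t ≡ fin 3) →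
      ∃ λ (j : Fin n) → (j ∈ y) × (toℕ j ≡ suc (toℕ i)))
lemma4p3p2 n M straight w fc i x y z w≈xiyiz red = upward , downward
  where
  open IsStraightLineCoxeter straight using (diag; symm)
  open CoxeterWords M diag symm using (ReducedExpression; ≈-sym)

  rexp : ReducedExpression w (x ++ i ∷ y ++ i ∷ z)
  rexp = ≈-sym w≈xiyiz , red

  upward : (∀ s t → toℕ i ≤ toℕ s → s ⋖ t → M s t ≡ fin 3) → ∃ λ j → j ∈ y × j ⋖ i
  upward simple with any? (_⋖? i) y
  ... | yes found = find found
  ... | no none = ⊥-elim (Up.no-repeat x y z ≤-refl (¬Any⇒All¬ y none) rexp)
    where
    module Up = StraightLineRay straight fc _⋖_ _⋖?_ id ⋖-functional ⋖-injective
                  (λ s → toℕ i ≤ toℕ s) (λ i≤s s⋖t → ≤-trans i≤s (⋖⇒≤ s⋖t))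
                  (simple _ _)

  downward : (∀ s t → toℕ s ≤ toℕ i → s ⋖ t → M s t ≡ fin 3) →
             ∃ λ j → j ∈ y × toℕ j ≡ suc (toℕ i)
  downward simple with any? (i ⋖?_) y
  ... | yes found = let j , j∈y , i⋖j = find found in j , j∈y , sym i⋖j
  ... | no none = ⊥-elim (Down.no-repeat x y z ≤-refl (¬Any⇒All¬ y none) rexp)
    where
    module Down = StraightLineRay straight fc (flip _⋖_) (flip _⋖?_) Sum.swap ⋖-injective ⋖-functional
                    (λ s → toℕ s ≤ toℕ i) (λ s≤i t⋖s → ≤-trans (⋖⇒≤ t⋖s) s≤i)
                    (λ {s} {t} s≤i t⋖s →
                       trans (symm s t) (simple t s (≤-trans (⋖⇒≤ t⋖s) s≤i) t⋖s))
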